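{- Let $k\geq 2$, $n\geq 1$ and $1\leq s\leq \min\{k-1,n\}$. Then $$f_k(n;s)=\sum_{j=0}^{s-1}(-1)^j\binom{s-1-j}{j}f_k(n-1-j).$$
   Context: A permutation $\alpha\in S_n$ contains a pattern $\tau\in S_m$ if there are indices $i_1<\dots<i_m$ with $(\alpha_{i_1},\dots,\alpha_{i_m})$ order-isomorphic to $\tau$; otherwise it avoids $\tau$. A permutation is $321$-$k$-gon-avoiding if it avoids $321$ and each of the four patterns $(k,k+2,k+3,\dots,2k-1,1,2k,2,3,\dots,k+1)$, $(k,k+2,k+3,\dots,2k-1,2k,1,2,3,\dots,k+1)$, $(k+1,k+2,k+3,\dots,2k-1,1,2k,2,3,\dots,k)$, $(k+1,k+2,k+3,\dots,2k-1,2k,1,2,3,\dots,k)$. $f_k(n)$ is the number of $321$-$k$-gon-avoiding permutations in $S_n$ ($f_k(0)=1$), and $f_k(n;i_1,\dots,i_m)$ is the number of $321$-$k$-gon-avoiding permutations $\pi\in S_n$ with $\pi_1\pi_2\cdots\pi_m=i_1i_2\cdots i_m$. -}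

module Defs where

open import Data.Bool using (Bool; true; false; _∧_; _∨_; not; if_then_else_)
open import Data.Nat using (ℕ; zero; suc; _+_; _∸_; _<ᵇ_; _≡ᵇ_)
open import Data.List using (List; []; _∷_; _++_; map; concatMap; length; filterᵇ; applyUpTo; zip; foldr)
open import Data.Product using (_×_; _,_)
open import Data.Integer as ℤ using (ℤ)
open import Data.Bool.ListAction using (all; any)

range : ℕ → ℕ → List ℕ
range a b = applyUpTo (λ i → a + i) (suc b ∸ a)

seqs : ℕ → List ℕ → List (List ℕ)
seqs zero    xs = [] ∷ []
seqs (suc m) xs = concatMap (λ x → map (x ∷_) (seqs m xs)) xs

elemᵇ : ℕ → List ℕ → Bool
elemᵇ x ys = any (λ y → x ≡ᵇ y) ys

distinctᵇ : List ℕ → Bool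
distinctᵇ []       = true
distinctᵇ (x ∷ xs) = not (elemᵇ x xs) ∧ distinctᵇ xs

-- S_n : permutations of {1,...,n} in one-line notation
perms : ℕ → List (List ℕ)
perms n = filterᵇ distinctᵇ (seqs n (range 1 n))

subseqs : List ℕ → List (List ℕ)
subseqs []       = [] ∷ []
subseqs (x ∷ xs) = subseqs xs ++ map (x ∷_) (subseqs xs)

orderIsoᵇ : List ℕ → List ℕ → Bool
orderIsoᵇ a b =
  (length a ≡ᵇ length b) ∧
  all (λ p → all (λ q → eqB (pr₁ p <ᵇ pr₁ q) (pr₂ p <ᵇ pr₂ q)) ps) ps
  where
    ps = zip a b
    pr₁ : ℕ × ℕ → ℕ
    pr₁ (x , _) = x
    pr₂ : ℕ × ℕ → ℕ
    pr₂ (_ , y) = y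
    eqB : Bool → Bool → Bool
    eqB true  y = y
    eqB false y = not y

containsᵇ : List ℕ → List ℕ → Bool
containsᵇ α τ = any (λ σ → orderIsoᵇ σ τ) (subseqs α)

-- The four k-gon patterns (in S_{2k}).  The final block "2,3,...,k+1" of the
-- first two patterns means 2,3,...,k-1,k+1 (the value k is already used).
gon₁ gon₂ gon₃ gon₄ : ℕ → List ℕ
gon₁ k = k ∷ range (k + 2) (k + k ∸ 1) ++ 1 ∷ (k + k) ∷ range 2 (k ∸ 1) ++ suc k ∷ []
gon₂ k = k ∷ range (k + 2) (k + k ∸ 1) ++ (k + k) ∷ 1 ∷ range 2 (k ∸ 1) ++ suc k ∷ []
gon₃ k = suc k ∷ range (k + 2) (k + k ∸ 1) ++ 1 ∷ (k + k) ∷ range 2 k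
gon₄ k = suc k ∷ range (k + 2) (k + k ∸ 1) ++ (k + k) ∷ 1 ∷ range 2 k

avoidsᵇ : List ℕ → List ℕ → Bool
avoidsᵇ α τ = not (containsᵇ α τ)

kgonAvoidingᵇ : ℕ → List ℕ → Bool
kgonAvoidingᵇ k α =
  avoidsᵇ α (3 ∷ 2 ∷ 1 ∷ []) ∧ avoidsᵇ α (gon₁ k) ∧ avoidsᵇ α (gon₂ k)
  ∧ avoidsᵇ α (gon₃ k) ∧ avoidsᵇ α (gon₄ k)

hasPrefixᵇ : List ℕ → List ℕ → Bool
hasPrefixᵇ []       _        = true
hasPrefixᵇ (i ∷ is) []       = false
hasPrefixᵇ (i ∷ is) (x ∷ xs) = (i ≡ᵇ x) ∧ hasPrefixᵇ is xs

f : ℕ → ℕ → ℕ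
f k n = length (filterᵇ (kgonAvoidingᵇ k) (perms n))

fPre : ℕ → ℕ → List ℕ → ℕ
fPre k n is = length (filterᵇ (λ π → kgonAvoidingᵇ k π ∧ hasPrefixᵇ is π) (perms n))

sumℤ : List ℤ → ℤ
sumℤ = foldr ℤ._+_ (ℤ.+ 0)

-- Write a permutation with first entry s < k as s ∷ punchIn s σ.  Each k-gon pattern begins with a
-- value of at least k and contains 1, …, k − 1, so no occurrence of it can use the entry s, while a
-- 321 through s is exactly an inversion of σ below s.  Hence f_k(n; s) counts the 321-k-gon-avoiding
-- σ ∈ S_{n−1} whose entries below s increase.  Sorting these σ by their first entry x, the case
-- x = 1 contributes f_k(n − 1; s − 1), the cases 1 < x < s contribute nothing (1 comes later), and
-- x ≥ s contributes f_k(n − 1; x).  So f_k(n; 1) = f_k(n; 2) = f_k(n − 1) and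
-- f_k(n; s) = f_k(n − 1; s − 1) + f_k(n; s + 1), which by Pascal's rule is also the recurrence of
-- the alternating binomial sums.

{-# OPTIONS --safe #-}
module Submission where

open import Defs
open import Data.Nat using (ℕ; _≤_; _∸_; _+_)
open import Data.Nat.Combinatorics using (_C_)
open import Data.Integer using (ℤ; +_; -_; _*_; _^_)
open import Data.List using (List; []; _∷_; map; upTo)
open import Relation.Binary.PropositionalEquality using (_≡_)

open import Data.Nat using (zero; suc; _<_; _<ᵇ_; _≡ᵇ_; z≤n; s≤s; _≟_)
import Data.Nat.Properties as ℕₚ
open import Data.Nat.Combinatorics using (nCk+nC[k+1]≡[n+1]C[k+1])
open import Data.Nat.ListAction using (sum)
import Data.Nat.ListAction.Properties as Sumₚ
open import Data.Integer using () renaming (_+_ to _+ℤ_; _-_ to _-ℤ_)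
import Data.Integer.Properties as ℤₚ
open import Data.Integer.Tactic.RingSolver using (solve-∀)
open import Data.Bool using (Bool; true; false; _∧_; _∨_; not; if_then_else_)
import Data.Bool.Properties as Boolₚ
open import Data.Bool.ListAction using (all; any; or)
open import Data.List using (_++_; concat; concatMap; length; filterᵇ; applyUpTo; zip)
import Data.List.Properties as Listₚ
open import Data.List.Membership.Propositional using (_∈_; find; lose)
import Data.List.Membership.Propositional.Properties as ∈ₚ
open import Data.List.Relation.Unary.All as All using (All; []; _∷_)
import Data.List.Relation.Unary.All.Properties as Allₚ
open import Data.List.Relation.Unary.Any using (here; there)
import Data.List.Relation.Unary.Any.Properties as Anyₚ
open import Data.Product as Product using (∃; ∃₂; _×_; _,_; proj₁; proj₂)
open import Data.Sum using (inj₁; inj₂)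
open import Function using (_∘_; _⇔_; mk⇔; Equivalence)
open import Relation.Binary.PropositionalEquality
  using (refl; sym; trans; cong; cong₂; subst; _≢_; module ≡-Reasoning)
open import Relation.Nullary using (yes; no; contradiction)

private
  variable
    A B : Set

<⇒<ᵇ≡true : ∀ {m n} → m < n → (m <ᵇ n) ≡ true
<⇒<ᵇ≡true {zero}  {suc n} _         = refl
<⇒<ᵇ≡true {suc m} {suc n} (s≤s m<n) = <⇒<ᵇ≡true m<n

≥⇒<ᵇ≡false : ∀ {m n} → n ≤ m → (m <ᵇ n) ≡ false
≥⇒<ᵇ≡false {zero}  {zero}  _         = refl
≥⇒<ᵇ≡false {suc m} {zero}  _         = refl
≥⇒<ᵇ≡false {suc m} {suc n} (s≤s n≤m) = ≥⇒<ᵇ≡false n≤m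

<ᵇ≡true⇒< : ∀ m n → (m <ᵇ n) ≡ true → m < n
<ᵇ≡true⇒< zero    (suc n) _  = s≤s z≤n
<ᵇ≡true⇒< (suc m) (suc n) eq = s≤s (<ᵇ≡true⇒< m n eq)

<ᵇ≡false⇒≥ : ∀ m n → (m <ᵇ n) ≡ false → n ≤ m
<ᵇ≡false⇒≥ m       zero    _  = z≤n
<ᵇ≡false⇒≥ (suc m) (suc n) eq = s≤s (<ᵇ≡false⇒≥ m n eq)

≡ᵇ-refl : ∀ n → (n ≡ᵇ n) ≡ true
≡ᵇ-refl zero    = refl
≡ᵇ-refl (suc n) = ≡ᵇ-refl n

≢⇒≡ᵇ≡false : ∀ {m n} → m ≢ n → (m ≡ᵇ n) ≡ false
≢⇒≡ᵇ≡false {m} {n} m≢n = Boolₚ.¬-not (m≢n ∘ ℕₚ.≡ᵇ⇒≡ m n ∘ Equivalence.from Boolₚ.T-≡)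

≡ᵇ-via-<ᵇ : ∀ m n → (m ≡ᵇ n) ≡ not (m <ᵇ n) ∧ not (n <ᵇ m)
≡ᵇ-via-<ᵇ zero    zero    = refl
≡ᵇ-via-<ᵇ zero    (suc n) = refl
≡ᵇ-via-<ᵇ (suc m) zero    = refl
≡ᵇ-via-<ᵇ (suc m) (suc n) = ≡ᵇ-via-<ᵇ m n

∧-trueʳ : ∀ {b c} → b ∧ c ≡ true → c ≡ true
∧-trueʳ {true} c≡true = c≡true

∧-falseʳ : ∀ {b c} → b ≡ true → b ∧ c ≡ false → c ≡ false
∧-falseʳ refl c≡false = c≡false

not-∨-not : ∀ x y → not (x ∨ not y) ≡ not x ∧ y
not-∨-not true  y = refl
not-∨-not false y = Boolₚ.not-involutive y

⇔⇒≡not : ∀ {P : Set} {x y} → x ≡ true ⇔ P → y ≡ false ⇔ P → x ≡ not y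
⇔⇒≡not {x = true}  {true}  x⇔ y⇔ = Equivalence.from y⇔ (Equivalence.to x⇔ refl)
⇔⇒≡not {x = true}  {false} _  _  = refl
⇔⇒≡not {x = false} {true}  _  _  = refl
⇔⇒≡not {x = false} {false} x⇔ y⇔ = Equivalence.from x⇔ (Equivalence.to y⇔ refl)

all≡true⁻ : ∀ {p : A → Bool} {xs x} → all p xs ≡ true → x ∈ xs → p x ≡ true
all≡true⁻ {p = p} {y ∷ ys} h (here refl) = Boolₚ.∧-conicalˡ (p y) (all p ys) h
all≡true⁻ {p = p} {y ∷ ys} h (there x∈) = all≡true⁻ (Boolₚ.∧-conicalʳ (p y) (all p ys) h) x∈

all≡false⁻ : ∀ {p : A → Bool} xs → all p xs ≡ false → ∃ λ x → x ∈ xs × p x ≡ false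
all≡false⁻ {p = p} (y ∷ ys) h with p y in py
... | false = y , here refl , py
... | true  with all≡false⁻ ys h
...   | x , x∈ , px = x , there x∈ , px

any≡true⁻ : ∀ (p : A → Bool) xs → any p xs ≡ true → ∃ λ x → x ∈ xs × p x ≡ true
any≡true⁻ p xs h with find (Anyₚ.any⁻ p xs (Equivalence.from Boolₚ.T-≡ h))
... | x , x∈ , px = x , x∈ , Equivalence.to Boolₚ.T-≡ px

any≡true⁺ : ∀ {p : A → Bool} {xs x} → x ∈ xs → p x ≡ true → any p xs ≡ true
any≡true⁺ {p = p} x∈ px = Equivalence.to Boolₚ.T-≡ (Anyₚ.any⁺ p (lose x∈ (Equivalence.from Boolₚ.T-≡ px)))

any≡false⁺ : ∀ {p : A → Bool} xs → (∀ {x} → x ∈ xs → p x ≡ false) → any p xs ≡ false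
any≡false⁺ []       _    = refl
any≡false⁺ (x ∷ xs) none rewrite none (here refl) = any≡false⁺ xs (none ∘ there)

any-map : ∀ (p : B → Bool) (g : A → B) xs → any p (map g xs) ≡ any (p ∘ g) xs
any-map p g xs = cong or (sym (Listₚ.map-∘ xs))

any-cong : ∀ {p q : A → Bool} → (∀ x → p x ≡ q x) → ∀ xs → any p xs ≡ any q xs
any-cong p≗q xs = cong or (Listₚ.map-cong p≗q xs)

any-++ : ∀ (p : A → Bool) xs ys → any p (xs ++ ys) ≡ any p xs ∨ any p ys
any-++ p []       ys = refl
any-++ p (x ∷ xs) ys = trans (cong (p x ∨_) (any-++ p xs ys)) (sym (Boolₚ.∨-assoc (p x) _ _))

filterᵇ-map : ∀ (p : B → Bool) (g : A → B) xs → filterᵇ p (map g xs) ≡ map g (filterᵇ (p ∘ g) xs)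
filterᵇ-map p g []       = refl
filterᵇ-map p g (x ∷ xs) with p (g x)
... | true  = cong (g x ∷_) (filterᵇ-map p g xs)
... | false = filterᵇ-map p g xs

filterᵇ-concatMap : ∀ (p : B → Bool) (g : A → List B) xs →
                    filterᵇ p (concatMap g xs) ≡ concatMap (filterᵇ p ∘ g) xs
filterᵇ-concatMap p g []       = refl
filterᵇ-concatMap p g (x ∷ xs) =
  trans (Listₚ.filter-++ (Boolₚ.T? ∘ p) (g x) (concatMap g xs))
        (cong (filterᵇ p (g x) ++_) (filterᵇ-concatMap p g xs))

filterᵇ-∧ : ∀ (p q : A → Bool) xs → filterᵇ (λ x → p x ∧ q x) xs ≡ filterᵇ q (filterᵇ p xs)
filterᵇ-∧ p q []       = refl
filterᵇ-∧ p q (x ∷ xs) with p x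
... | false = filterᵇ-∧ p q xs
... | true with q x
...   | true  = cong (x ∷_) (filterᵇ-∧ p q xs)
...   | false = filterᵇ-∧ p q xs

filterᵇ-cong : ∀ {p q : A → Bool} xs → (∀ {x} → x ∈ xs → p x ≡ q x) → filterᵇ p xs ≡ filterᵇ q xs
filterᵇ-cong         []       _   = refl
filterᵇ-cong {q = q} (x ∷ xs) p≗q rewrite p≗q (here refl) with q x
... | true  = cong (x ∷_) (filterᵇ-cong xs (p≗q ∘ there))
... | false = filterᵇ-cong xs (p≗q ∘ there)

filterᵇ-none : ∀ {p : A → Bool} xs → (∀ {x} → x ∈ xs → p x ≡ false) → filterᵇ p xs ≡ []
filterᵇ-none []       _    = refl
filterᵇ-none (x ∷ xs) none rewrite none (here refl) = filterᵇ-none xs (none ∘ there)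

filterᵇ-all : ∀ {p : A → Bool} xs → (∀ {x} → x ∈ xs → p x ≡ true) → filterᵇ p xs ≡ xs
filterᵇ-all []       _     = refl
filterᵇ-all (x ∷ xs) every rewrite every (here refl) = cong (x ∷_) (filterᵇ-all xs (every ∘ there))

map-cong-∈ : ∀ {f g : A → B} xs → (∀ {x} → x ∈ xs → f x ≡ g x) → map f xs ≡ map g xs
map-cong-∈ xs f≗g = Listₚ.map-cong-local (All.tabulate f≗g)

count : (A → Bool) → List A → ℕ
count p = length ∘ filterᵇ p

count-map : ∀ (p : B → Bool) (g : A → B) xs → count p (map g xs) ≡ count (p ∘ g) xs
count-map p g xs = trans (cong length (filterᵇ-map p g xs)) (Listₚ.length-map g (filterᵇ (p ∘ g) xs))

length-concatMap : ∀ (g : A → List B) xs → length (concatMap g xs) ≡ sum (map (length ∘ g) xs)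
length-concatMap g []       = refl
length-concatMap g (x ∷ xs) =
  trans (Listₚ.length-++ (g x)) (cong (λ n → length (g x) + n) (length-concatMap g xs))

count-concatMap : ∀ (p : B → Bool) (g : A → List B) xs →
                  count p (concatMap g xs) ≡ sum (map (count p ∘ g) xs)
count-concatMap p g xs =
  trans (cong length (filterᵇ-concatMap p g xs)) (length-concatMap (filterᵇ p ∘ g) xs)

count-cong : ∀ {p q : A → Bool} xs → (∀ {x} → x ∈ xs → p x ≡ q x) → count p xs ≡ count q xs
count-cong xs p≗q = cong length (filterᵇ-cong xs p≗q)

count-none : ∀ {p : A → Bool} xs → (∀ {x} → x ∈ xs → p x ≡ false) → count p xs ≡ 0
count-none xs none = cong length (filterᵇ-none xs none)

sum-map-zero : ∀ {g : A → ℕ} xs → (∀ {x} → x ∈ xs → g x ≡ 0) → sum (map g xs) ≡ 0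
sum-map-zero []       _    = refl
sum-map-zero (x ∷ xs) vanish rewrite vanish (here refl) = sum-map-zero xs (vanish ∘ there)

interval : ℕ → ℕ → List ℕ
interval a zero    = []
interval a (suc l) = a ∷ interval (suc a) l

applyUpTo≡interval : ∀ {f : ℕ → ℕ} a l → (∀ i → f i ≡ a + i) → applyUpTo f l ≡ interval a l
applyUpTo≡interval a zero    _   = refl
applyUpTo≡interval a (suc l) f≗ = cong₂ _∷_
  (trans (f≗ 0) (ℕₚ.+-identityʳ a))
  (applyUpTo≡interval (suc a) l (λ i → trans (f≗ (suc i)) (ℕₚ.+-suc a i)))

range≡interval : ∀ a b → range a b ≡ interval a (suc b ∸ a)
range≡interval a b = applyUpTo≡interval a (suc b ∸ a) (λ _ → refl)

interval-++ : ∀ a l m → interval a (l + m) ≡ interval a l ++ interval (a + l) m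
interval-++ a zero    m = cong (λ b → interval b m) (sym (ℕₚ.+-identityʳ a))
interval-++ a (suc l) m = cong (a ∷_)
  (trans (interval-++ (suc a) l m) (cong (λ b → interval (suc a) l ++ interval b m) (sym (ℕₚ.+-suc a l))))

∈-interval⁻ : ∀ {x} a l → x ∈ interval a l → a ≤ x × x < a + l
∈-interval⁻ a (suc l) (here refl) = ℕₚ.≤-refl , ℕₚ.m<m+n a (s≤s z≤n)
∈-interval⁻ {x} a (suc l) (there x∈) with ∈-interval⁻ (suc a) l x∈
... | a<x , x<1+a+l = ℕₚ.<⇒≤ a<x , subst (x <_) (sym (ℕₚ.+-suc a l)) x<1+a+l

∈-interval⁺ : ∀ {v} a l → a ≤ v → v < a + l → v ∈ interval a l
∈-interval⁺ {v} a zero    a≤v v<a+0 = contradiction (subst (v <_) (ℕₚ.+-identityʳ a) v<a+0) (ℕₚ.≤⇒≯ a≤v)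
∈-interval⁺ {v} a (suc l) a≤v v<a+1+l with a ≟ v
... | yes refl = here refl
... | no a≢v   = there (∈-interval⁺ (suc a) l (ℕₚ.≤∧≢⇒< a≤v a≢v) (subst (v <_) (ℕₚ.+-suc a l) v<a+1+l))

∈-range⁺ : ∀ {v} a b → a ≤ v → v ≤ b → v ∈ range a b
∈-range⁺ {v} a b a≤v v≤b = subst (v ∈_) (sym (range≡interval a b))
  (∈-interval⁺ a (suc b ∸ a) a≤v (subst (v <_) (sym (ℕₚ.m+[n∸m]≡n a≤1+b)) (s≤s v≤b)))
  where a≤1+b = ℕₚ.m≤n⇒m≤1+n (ℕₚ.≤-trans a≤v v≤b)

sum-interval-point : ∀ {x} (g : ℕ → ℕ) a l → a ≤ x → x < a + l → (∀ y → y ≢ x → g y ≡ 0) →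
                     sum (map g (interval a l)) ≡ g x
sum-interval-point     g a zero    a≤x x<a+0 _ =
  contradiction (subst (_ <_) (ℕₚ.+-identityʳ a) x<a+0) (ℕₚ.≤⇒≯ a≤x)
sum-interval-point {x} g a (suc l) a≤x x<a+1+l vanish with a ≟ x
... | yes refl =
  trans (cong (λ n → g a + n) (sum-map-zero (interval (suc a) l) above)) (ℕₚ.+-identityʳ (g a))
  where
  above : ∀ {y} → y ∈ interval (suc a) l → g y ≡ 0
  above y∈ = vanish _ (ℕₚ.>⇒≢ (proj₁ (∈-interval⁻ (suc a) l y∈)))
... | no a≢x = trans (cong (λ n → n + sum (map g (interval (suc a) l))) (vanish a a≢x))
  (sum-interval-point g (suc a) l (ℕₚ.≤∧≢⇒< a≤x a≢x) (subst (x <_) (ℕₚ.+-suc a l) x<a+1+l) vanish)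

OrderEmbedding : (ℕ → ℕ) → Set
OrderEmbedding φ = ∀ a b → (φ a <ᵇ φ b) ≡ (a <ᵇ b)

punchIn : ℕ → ℕ → ℕ
punchIn x v = if v <ᵇ x then v else suc v

punchIn-< : ∀ {x v} → v < x → punchIn x v ≡ v
punchIn-< v<x rewrite <⇒<ᵇ≡true v<x = refl

punchIn-≥ : ∀ {x v} → x ≤ v → punchIn x v ≡ suc v
punchIn-≥ x≤v rewrite ≥⇒<ᵇ≡false x≤v = refl

punchIn-inflationary : ∀ x v → v ≤ punchIn x v
punchIn-inflationary x v with v <ᵇ x
... | true  = ℕₚ.≤-refl
... | false = ℕₚ.n≤1+n v

punchIn-positive : ∀ x zs → All (1 ≤_) zs → All (1 ≤_) (map (punchIn x) zs)
punchIn-positive x zs pos = Allₚ.map⁺ (All.map (λ {v} 1≤v → ℕₚ.≤-trans 1≤v (punchIn-inflationary x v)) pos)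

punchIn-<ᵇ : ∀ x v → (punchIn x v <ᵇ x) ≡ (v <ᵇ x)
punchIn-<ᵇ x v with v <ᵇ x in v<ᵇx
... | true  = v<ᵇx
... | false = ≥⇒<ᵇ≡false (ℕₚ.m≤n⇒m≤1+n (<ᵇ≡false⇒≥ v x v<ᵇx))

punchIn-orderEmbedding : ∀ x → OrderEmbedding (punchIn x)
punchIn-orderEmbedding x a b with a <ᵇ x in a<ᵇx | b <ᵇ x in b<ᵇx
... | true  | true  = refl
... | false | false = refl
... | true  | false = trans (<⇒<ᵇ≡true (ℕₚ.m<n⇒m<1+n a<b)) (sym (<⇒<ᵇ≡true a<b))
  where a<b = ℕₚ.<-≤-trans (<ᵇ≡true⇒< a x a<ᵇx) (<ᵇ≡false⇒≥ b x b<ᵇx)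
... | false | true  = trans (≥⇒<ᵇ≡false (ℕₚ.m≤n⇒m≤1+n b≤a)) (sym (≥⇒<ᵇ≡false b≤a))
  where b≤a = ℕₚ.<⇒≤ (ℕₚ.<-≤-trans (<ᵇ≡true⇒< b x b<ᵇx) (<ᵇ≡false⇒≥ a x a<ᵇx))

map-punchIn-interval : ∀ {x} a l → x ≤ a → map (punchIn x) (interval a l) ≡ interval (suc a) l
map-punchIn-interval a zero    _   = refl
map-punchIn-interval a (suc l) x≤a =
  cong₂ _∷_ (punchIn-≥ x≤a) (map-punchIn-interval (suc a) l (ℕₚ.m≤n⇒m≤1+n x≤a))

filterᵇ-≢-interval : ∀ {x} a l → a ≤ x → x < a + suc l →
  filterᵇ (λ y → not (x ≡ᵇ y)) (interval a (suc l)) ≡ map (punchIn x) (interval a l)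
filterᵇ-≢-interval {x} a l a≤x x<a+1+l with a ≟ x
... | yes refl rewrite ≡ᵇ-refl a = trans (filterᵇ-all (interval (suc a) l) above)
                                          (sym (map-punchIn-interval a l ℕₚ.≤-refl))
  where
  above : ∀ {y} → y ∈ interval (suc a) l → not (a ≡ᵇ y) ≡ true
  above y∈ = cong not (≢⇒≡ᵇ≡false (ℕₚ.<⇒≢ (proj₁ (∈-interval⁻ (suc a) l y∈))))
filterᵇ-≢-interval {x} a zero a≤x x<a+1 | no a≢x =
  contradiction (ℕₚ.≤∧≢⇒< a≤x a≢x) (ℕₚ.≤⇒≯ (ℕₚ.≤-pred (subst (x <_) (ℕₚ.+-comm a 1) x<a+1)))
filterᵇ-≢-interval {x} a (suc l) a≤x x<a+2+l | no a≢x
  rewrite ≢⇒≡ᵇ≡false (a≢x ∘ sym) | punchIn-< (ℕₚ.≤∧≢⇒< a≤x a≢x) =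
  cong (a ∷_) (filterᵇ-≢-interval (suc a) l (ℕₚ.≤∧≢⇒< a≤x a≢x) (subst (x <_) (ℕₚ.+-suc a (suc l)) x<a+2+l))

elemᵇ-map : ∀ {φ} → OrderEmbedding φ → ∀ z zs → elemᵇ (φ z) (map φ zs) ≡ elemᵇ z zs
elemᵇ-map         emb z []       = refl
elemᵇ-map {φ = φ} emb z (y ∷ ys) = cong₂ _∨_ same (elemᵇ-map emb z ys)
  where
  same : (φ z ≡ᵇ φ y) ≡ (z ≡ᵇ y)
  same = trans (≡ᵇ-via-<ᵇ (φ z) (φ y))
    (trans (cong₂ (λ b c → not b ∧ not c) (emb z y) (emb y z)) (sym (≡ᵇ-via-<ᵇ z y)))

distinctᵇ-map : ∀ {φ} → OrderEmbedding φ → ∀ zs → distinctᵇ (map φ zs) ≡ distinctᵇ zs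
distinctᵇ-map emb []       = refl
distinctᵇ-map emb (z ∷ zs) = cong₂ (λ b c → not b ∧ c) (elemᵇ-map emb z zs) (distinctᵇ-map emb zs)

-- Permutations by their first entry

seqs-map : ∀ (φ : ℕ → ℕ) m xs → seqs m (map φ xs) ≡ map (map φ) (seqs m xs)
seqs-map φ zero    xs = refl
seqs-map φ (suc m) xs = begin
  concatMap (λ y → map (y ∷_) (seqs m (map φ xs))) (map φ xs)
    ≡⟨ cong (λ S′ → concatMap (λ y → map (y ∷_) S′) (map φ xs)) (seqs-map φ m xs) ⟩
  concatMap (λ y → map (y ∷_) (map (map φ) S)) (map φ xs)
    ≡⟨ Listₚ.concatMap-map (λ y → map (y ∷_) (map (map φ) S)) φ xs ⟩
  concatMap (λ x → map (φ x ∷_) (map (map φ) S)) xs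
    ≡⟨ Listₚ.concatMap-cong (λ x → trans (sym (Listₚ.map-∘ S)) (Listₚ.map-∘ S)) xs ⟩
  concatMap (λ x → map (map φ) (map (x ∷_) S)) xs
    ≡⟨ Listₚ.map-concatMap (map φ) (λ x → map (x ∷_) S) xs ⟨
  map (map φ) (concatMap (λ x → map (x ∷_) S) xs) ∎
  where
  open ≡-Reasoning
  S = seqs m xs

filterᵇ-all-seqs : ∀ (p : ℕ → Bool) m xs → filterᵇ (all p) (seqs m xs) ≡ seqs m (filterᵇ p xs)
filterᵇ-all-seqs p zero    xs = refl
filterᵇ-all-seqs p (suc m) xs = extend xs
  where
  S = seqs m xs
  extend : ∀ ys → filterᵇ (all p) (concatMap (λ y → map (y ∷_) S) ys)
                ≡ concatMap (λ y → map (y ∷_) (seqs m (filterᵇ p xs))) (filterᵇ p ys)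
  extend []       = refl
  extend (y ∷ ys) with p y in py
  ... | true  = trans (Listₚ.filter-++ (Boolₚ.T? ∘ all p) (map (y ∷_) S) _)
    (cong₂ _++_ (trans (filterᵇ-map (all p) (y ∷_) S)
                       (cong (map (y ∷_)) (trans (filterᵇ-cong S (λ {zs} _ → cong (_∧ all p zs) py))
                                                 (filterᵇ-all-seqs p m xs))))
                (extend ys))
  ... | false = trans (Listₚ.filter-++ (Boolₚ.T? ∘ all p) (map (y ∷_) S) _)
    (cong₂ _++_ (trans (filterᵇ-map (all p) (y ∷_) S)
                       (cong (map (y ∷_)) (filterᵇ-none S (λ {zs} _ → cong (_∧ all p zs) py))))
                (extend ys))

not-elemᵇ : ∀ x ys → not (elemᵇ x ys) ≡ all (λ y → not (x ≡ᵇ y)) ys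
not-elemᵇ x []       = refl
not-elemᵇ x (y ∷ ys) with x ≡ᵇ y
... | true  = refl
... | false = not-elemᵇ x ys

perms≡ : ∀ n → perms n ≡ filterᵇ distinctᵇ (seqs n (interval 1 n))
perms≡ n = cong (filterᵇ distinctᵇ ∘ seqs n) (range≡interval 1 n)

perms-with-head : ∀ M x → 1 ≤ x → x ≤ suc M →
  filterᵇ distinctᵇ (map (x ∷_) (seqs M (interval 1 (suc M))))
    ≡ map (λ zs → x ∷ map (punchIn x) zs) (perms M)
perms-with-head M x 1≤x x≤1+M = begin
  filterᵇ distinctᵇ (map (x ∷_) S)
    ≡⟨ filterᵇ-map distinctᵇ (x ∷_) S ⟩
  map (x ∷_) (filterᵇ (λ ys → not (elemᵇ x ys) ∧ distinctᵇ ys) S)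
    ≡⟨ cong (map (x ∷_)) (filterᵇ-∧ (not ∘ elemᵇ x) distinctᵇ S) ⟩
  map (x ∷_) (filterᵇ distinctᵇ (filterᵇ (not ∘ elemᵇ x) S))
    ≡⟨ cong (map (x ∷_) ∘ filterᵇ distinctᵇ) avoiding-x ⟩
  map (x ∷_) (filterᵇ distinctᵇ (map (map (punchIn x)) S′))
    ≡⟨ cong (map (x ∷_)) (filterᵇ-map distinctᵇ (map (punchIn x)) S′) ⟩
  map (x ∷_) (map (map (punchIn x)) (filterᵇ (distinctᵇ ∘ map (punchIn x)) S′))
    ≡⟨ cong (map (x ∷_) ∘ map (map (punchIn x))) distinct-relabelled ⟩
  map (x ∷_) (map (map (punchIn x)) (perms M))
    ≡⟨ Listₚ.map-∘ (perms M) ⟨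
  map (λ zs → x ∷ map (punchIn x) zs) (perms M) ∎
  where
  open ≡-Reasoning
  S  = seqs M (interval 1 (suc M))
  S′ = seqs M (interval 1 M)
  avoiding-x : filterᵇ (not ∘ elemᵇ x) S ≡ map (map (punchIn x)) S′
  avoiding-x = begin
    filterᵇ (not ∘ elemᵇ x) S
      ≡⟨ filterᵇ-cong S (λ {ys} _ → not-elemᵇ x ys) ⟩
    filterᵇ (all (λ y → not (x ≡ᵇ y))) S
      ≡⟨ filterᵇ-all-seqs (λ y → not (x ≡ᵇ y)) M (interval 1 (suc M)) ⟩
    seqs M (filterᵇ (λ y → not (x ≡ᵇ y)) (interval 1 (suc M)))
      ≡⟨ cong (seqs M) (filterᵇ-≢-interval 1 M 1≤x (s≤s x≤1+M)) ⟩
    seqs M (map (punchIn x) (interval 1 M))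
      ≡⟨ seqs-map (punchIn x) M (interval 1 M) ⟩
    map (map (punchIn x)) S′ ∎
  distinct-relabelled : filterᵇ (distinctᵇ ∘ map (punchIn x)) S′ ≡ perms M
  distinct-relabelled =
    trans (filterᵇ-cong S′ (λ {zs} _ → distinctᵇ-map (punchIn-orderEmbedding x) zs)) (sym (perms≡ M))

perms-suc : ∀ M → perms (suc M)
          ≡ concatMap (λ x → map (λ zs → x ∷ map (punchIn x) zs) (perms M)) (interval 1 (suc M))
perms-suc M = begin
  perms (suc M)
    ≡⟨ perms≡ (suc M) ⟩
  filterᵇ distinctᵇ (concatMap (λ x → map (x ∷_) (seqs M I)) I)
    ≡⟨ filterᵇ-concatMap distinctᵇ (λ x → map (x ∷_) (seqs M I)) I ⟩
  concatMap (λ x → filterᵇ distinctᵇ (map (x ∷_) (seqs M I))) I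
    ≡⟨ cong concat (map-cong-∈ I head∈I) ⟩
  concatMap (λ x → map (λ zs → x ∷ map (punchIn x) zs) (perms M)) I ∎
  where
  open ≡-Reasoning
  I = interval 1 (suc M)
  head∈I : ∀ {x} → x ∈ I →
    filterᵇ distinctᵇ (map (x ∷_) (seqs M I)) ≡ map (λ zs → x ∷ map (punchIn x) zs) (perms M)
  head∈I {x} x∈I with ∈-interval⁻ 1 (suc M) x∈I
  ... | 1≤x , x<2+M = perms-with-head M x 1≤x (ℕₚ.≤-pred x<2+M)

∈-perms-suc⁻ : ∀ {π} M → π ∈ perms (suc M) →
  ∃₂ λ x zs → x ∈ interval 1 (suc M) × zs ∈ perms M × π ≡ x ∷ map (punchIn x) zs
∈-perms-suc⁻ M π∈
  with find (∈ₚ.∈-concatMap⁻ (λ x → map (λ zs → x ∷ map (punchIn x) zs) (perms M)) {xs = interval 1 (suc M)}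
                             (subst (_ ∈_) (perms-suc M) π∈))
... | x , x∈ , π∈x with ∈ₚ.∈-map⁻ (λ zs → x ∷ map (punchIn x) zs) π∈x
...   | zs , zs∈ , refl = x , zs , x∈ , zs∈ , refl

perms-positive : ∀ {π} M → π ∈ perms M → All (1 ≤_) π
perms-positive zero    (here refl) = []
perms-positive (suc M) π∈ with ∈-perms-suc⁻ M π∈
... | x , zs , x∈ , zs∈ , refl =
  proj₁ (∈-interval⁻ 1 (suc M) x∈) ∷ punchIn-positive x zs (perms-positive M zs∈)

1∈perms : ∀ {π} M → π ∈ perms (suc M) → 1 ∈ π
1∈perms zero π∈ with ∈-perms-suc⁻ zero π∈
... | x , zs , here refl , _ , refl = here refl
1∈perms (suc M) π∈ with ∈-perms-suc⁻ (suc M) π∈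
... | x , zs , x∈ , zs∈ , refl with x ≟ 1
...   | yes refl = here refl
...   | no x≢1   = there (subst (_∈ map (punchIn x) zs)
  (punchIn-< (ℕₚ.≤∧≢⇒< (proj₁ (∈-interval⁻ 1 (suc (suc M)) x∈)) (x≢1 ∘ sym)))
  (∈ₚ.∈-map⁺ (punchIn x) (1∈perms M zs∈)))

count-perms-suc : ∀ (P : List ℕ → Bool) M → count P (perms (suc M))
  ≡ sum (map (λ x → count (λ zs → P (x ∷ map (punchIn x) zs)) (perms M)) (interval 1 (suc M)))
count-perms-suc P M = begin
  count P (perms (suc M))
    ≡⟨ cong (count P) (perms-suc M) ⟩
  count P (concatMap withHead I)
    ≡⟨ count-concatMap P withHead I ⟩
  sum (map (count P ∘ withHead) I)
    ≡⟨ cong sum (Listₚ.map-cong (λ x → count-map P (λ zs → x ∷ map (punchIn x) zs) (perms M)) I) ⟩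
  sum (map (λ x → count (λ zs → P (x ∷ map (punchIn x) zs)) (perms M)) I) ∎
  where
  open ≡-Reasoning
  I = interval 1 (suc M)
  withHead : ℕ → List (List ℕ)
  withHead x = map (λ zs → x ∷ map (punchIn x) zs) (perms M)

count-perms-suc-head : ∀ (P : List ℕ → Bool) M x → 1 ≤ x → x ≤ suc M →
  count (λ π → P π ∧ hasPrefixᵇ (x ∷ []) π) (perms (suc M))
    ≡ count (λ zs → P (x ∷ map (punchIn x) zs)) (perms M)
count-perms-suc-head P M x 1≤x x≤1+M =
  trans (count-perms-suc _ M) (trans (sum-interval-point g 1 (suc M) 1≤x (s≤s x≤1+M) vanish) at-x)
  where
  g : ℕ → ℕ
  g y = count (λ zs → P (y ∷ map (punchIn y) zs) ∧ ((x ≡ᵇ y) ∧ true)) (perms M)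
  vanish : ∀ y → y ≢ x → g y ≡ 0
  vanish y y≢x = count-none (perms M) (λ {zs} _ →
    trans (cong (λ b → P (y ∷ map (punchIn y) zs) ∧ (b ∧ true)) (≢⇒≡ᵇ≡false (y≢x ∘ sym))) (Boolₚ.∧-zeroʳ _))
  at-x : g x ≡ count (λ zs → P (x ∷ map (punchIn x) zs)) (perms M)
  at-x = count-cong (perms M) (λ {zs} _ →
    trans (cong (λ b → P (x ∷ map (punchIn x) zs) ∧ (b ∧ true)) (≡ᵇ-refl x)) (Boolₚ.∧-identityʳ _))

-- Pattern containment

[]∈subseqs : ∀ ws → [] ∈ subseqs ws
[]∈subseqs []       = here refl
[]∈subseqs (w ∷ ws) = ∈ₚ.∈-++⁺ˡ ([]∈subseqs ws)

[-]∈subseqs : ∀ {b ws} → b ∈ ws → (b ∷ []) ∈ subseqs ws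
[-]∈subseqs {ws = w ∷ ws} (here refl) = ∈ₚ.∈-++⁺ʳ (subseqs ws) (∈ₚ.∈-map⁺ (w ∷_) ([]∈subseqs ws))
[-]∈subseqs {ws = w ∷ ws} (there b∈)  = ∈ₚ.∈-++⁺ˡ ([-]∈subseqs b∈)

subseqs-⊆ : ∀ {σ ws x} → σ ∈ subseqs ws → x ∈ σ → x ∈ ws
subseqs-⊆ {ws = []}     (here refl) ()
subseqs-⊆ {ws = w ∷ ws} σ∈ x∈ with ∈ₚ.∈-++⁻ (subseqs ws) σ∈
... | inj₁ σ∈ws = there (subseqs-⊆ σ∈ws x∈)
... | inj₂ σ∈w∷ with ∈ₚ.∈-map⁻ (w ∷_) σ∈w∷ | x∈
...   | σ′ , σ′∈ , refl | here refl   = here refl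
...   | σ′ , σ′∈ , refl | there x∈σ′ = there (subseqs-⊆ σ′∈ x∈σ′)

subseqs-map : ∀ (φ : ℕ → ℕ) zs → subseqs (map φ zs) ≡ map (map φ) (subseqs zs)
subseqs-map φ []       = refl
subseqs-map φ (z ∷ zs) rewrite subseqs-map φ zs = sym (trans
  (Listₚ.map-++ (map φ) (subseqs zs) (map (z ∷_) (subseqs zs)))
  (cong (map (map φ) (subseqs zs) ++_) (trans (sym (Listₚ.map-∘ (subseqs zs))) (Listₚ.map-∘ (subseqs zs)))))

SameOrder : List ℕ → List ℕ → Set
SameOrder a b = ∀ {x y x′ y′} → (x , y) ∈ zip a b → (x′ , y′) ∈ zip a b → (x <ᵇ x′) ≡ (y <ᵇ y′)

orderIsoᵇ-sound : ∀ a b → orderIsoᵇ a b ≡ true → length a ≡ length b × SameOrder a b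
orderIsoᵇ-sound a b iso = ℕₚ.≡ᵇ⇒≡ _ _ (Equivalence.from Boolₚ.T-≡ (Boolₚ.∧-conicalˡ _ _ iso)) , same
  where
  same : SameOrder a b
  -- Fixing the first conjunct keeps x <ᵇ x′ and y <ᵇ y′ literally visible, so the with below abstracts them.
  same {x} {y} {x′} {y′} xy∈ x′y′∈
    with x <ᵇ x′ | y <ᵇ y′ | all≡true⁻ (all≡true⁻ (∧-trueʳ {b = length a ≡ᵇ length b} iso) xy∈) x′y′∈
  ... | true  | true  | _  = refl
  ... | false | false | _  = refl
  ... | true  | false | ()
  ... | false | true  | ()

orderIsoᵇ-complete : ∀ a b → length a ≡ length b → SameOrder a b → orderIsoᵇ a b ≡ true
orderIsoᵇ-complete a b len same with orderIsoᵇ a b in iso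
... | true  = refl
... | false
  with all≡false⁻ (zip a b) (∧-falseʳ (Equivalence.to Boolₚ.T-≡ (ℕₚ.≡⇒≡ᵇ _ _ len)) iso)
...   | (x , y) , xy∈ , h with all≡false⁻ (zip a b) h
...     | (x′ , y′) , x′y′∈ , h′ with x <ᵇ x′ | y <ᵇ y′ | same xy∈ x′y′∈ | h′
...       | true  | true  | _  | ()
...       | false | false | _  | ()
...       | true  | false | () | _
...       | false | true  | () | _

zip-map₁ : ∀ (φ : ℕ → ℕ) σ (τ : List ℕ) → zip (map φ σ) τ ≡ map (Product.map₁ φ) (zip σ τ)
zip-map₁ φ []      τ       = refl
zip-map₁ φ (x ∷ σ) []      = refl
zip-map₁ φ (x ∷ σ) (y ∷ τ) = cong ((φ x , y) ∷_) (zip-map₁ φ σ τ)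

orderIsoᵇ-map : ∀ {φ} → OrderEmbedding φ → ∀ σ τ → orderIsoᵇ (map φ σ) τ ≡ orderIsoᵇ σ τ
orderIsoᵇ-map {φ} emb σ τ = Boolₚ.⇔→≡ (mk⇔ unmapped mapped)
  where
  from-map : ∀ {u y} → (u , y) ∈ zip (map φ σ) τ → ∃ λ x → u ≡ φ x × (x , y) ∈ zip σ τ
  from-map uy∈ with ∈ₚ.∈-map⁻ (Product.map₁ φ) (subst (_ ∈_) (zip-map₁ φ σ τ) uy∈)
  ... | (x , y) , xy∈ , refl = x , refl , xy∈
  to-map : ∀ {x y} → (x , y) ∈ zip σ τ → (φ x , y) ∈ zip (map φ σ) τ
  to-map xy∈ = subst (_ ∈_) (sym (zip-map₁ φ σ τ)) (∈ₚ.∈-map⁺ (Product.map₁ φ) xy∈)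
  unmapped : orderIsoᵇ (map φ σ) τ ≡ true → orderIsoᵇ σ τ ≡ true
  unmapped iso with orderIsoᵇ-sound (map φ σ) τ iso
  ... | len , same = orderIsoᵇ-complete σ τ (trans (sym (Listₚ.length-map φ σ)) len)
    (λ {x} {_} {x′} xy∈ x′y′∈ → trans (sym (emb x x′)) (same (to-map xy∈) (to-map x′y′∈)))
  mapped : orderIsoᵇ σ τ ≡ true → orderIsoᵇ (map φ σ) τ ≡ true
  mapped iso with orderIsoᵇ-sound σ τ iso
  ... | len , same = orderIsoᵇ-complete (map φ σ) τ (trans (Listₚ.length-map φ σ) len) same′
    where
    same′ : SameOrder (map φ σ) τ
    same′ uy∈ u′y′∈ with from-map uy∈ | from-map u′y′∈
    ... | x , refl , xy∈ | x′ , refl , x′y′∈ = trans (emb x x′) (same xy∈ x′y′∈)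

zip-∈ʳ : ∀ {a b : List ℕ} → length a ≡ length b → ∀ {v} → v ∈ b → ∃ λ x → (x , v) ∈ zip a b
zip-∈ʳ {x ∷ a} {y ∷ b} len (here refl) = x , here refl
zip-∈ʳ {x ∷ a} {y ∷ b} len (there v∈) with zip-∈ʳ (ℕₚ.suc-injective len) v∈
... | x′ , x′v∈ = x′ , there x′v∈

zip-∈ˡ : ∀ {a b : List ℕ} {x v} → (x , v) ∈ zip a b → x ∈ a
zip-∈ˡ {_ ∷ a} {_ ∷ b} (here refl) = here refl
zip-∈ˡ {_ ∷ a} {_ ∷ b} (there xv∈) = there (zip-∈ˡ xv∈)

containsᵇ-cons : ∀ s ws τ →
  containsᵇ (s ∷ ws) τ ≡ containsᵇ ws τ ∨ any (λ σ → orderIsoᵇ (s ∷ σ) τ) (subseqs ws)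
containsᵇ-cons s ws τ = trans (any-++ _ (subseqs ws) (map (s ∷_) (subseqs ws)))
  (cong (containsᵇ ws τ ∨_) (any-map (λ σ → orderIsoᵇ σ τ) (s ∷_) (subseqs ws)))

containsᵇ-map : ∀ {φ} → OrderEmbedding φ → ∀ zs τ → containsᵇ (map φ zs) τ ≡ containsᵇ zs τ
containsᵇ-map {φ} emb zs τ = begin
  any (λ σ → orderIsoᵇ σ τ) (subseqs (map φ zs))
    ≡⟨ cong (any (λ σ → orderIsoᵇ σ τ)) (subseqs-map φ zs) ⟩
  any (λ σ → orderIsoᵇ σ τ) (map (map φ) (subseqs zs))
    ≡⟨ any-map (λ σ → orderIsoᵇ σ τ) (map φ) (subseqs zs) ⟩
  any (λ σ → orderIsoᵇ (map φ σ) τ) (subseqs zs)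
    ≡⟨ any-cong (λ σ → orderIsoᵇ-map emb σ τ) (subseqs zs) ⟩
  any (λ σ → orderIsoᵇ σ τ) (subseqs zs) ∎
  where open ≡-Reasoning

-- Occurrences through the first entry

increasingBelowᵇ : ℕ → List ℕ → Bool
increasingBelowᵇ s []       = true
increasingBelowᵇ s (x ∷ xs) = not ((x <ᵇ s) ∧ any (_<ᵇ x) xs) ∧ increasingBelowᵇ s xs

InversionBelow : ℕ → List ℕ → Set
InversionBelow s ws = ∃₂ λ a b → (a ∷ b ∷ []) ∈ subseqs ws × b < a × a < s

increasingBelowᵇ≡false⇔ : ∀ s ws → increasingBelowᵇ s ws ≡ false ⇔ InversionBelow s ws
increasingBelowᵇ≡false⇔ s ws = mk⇔ (to ws) (from ws)
  where
  to : ∀ vs → increasingBelowᵇ s vs ≡ false → InversionBelow s vs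
  to (w ∷ vs) h with (w <ᵇ s) ∧ any (_<ᵇ w) vs in top
  ... | false with to vs h
  ...   | a , b , ab∈ , b<a , a<s = a , b , ∈ₚ.∈-++⁺ˡ ab∈ , b<a , a<s
  to (w ∷ vs) h | true with any≡true⁻ (_<ᵇ w) vs (Boolₚ.∧-conicalʳ (w <ᵇ s) _ top)
  ... | b , b∈ , b<ᵇw = w , b , ∈ₚ.∈-++⁺ʳ (subseqs vs) (∈ₚ.∈-map⁺ (w ∷_) ([-]∈subseqs b∈))
                      , <ᵇ≡true⇒< b w b<ᵇw , <ᵇ≡true⇒< w s (Boolₚ.∧-conicalˡ (w <ᵇ s) _ top)
  from : ∀ vs → InversionBelow s vs → increasingBelowᵇ s vs ≡ false
  from [] (_ , _ , here () , _)
  from (w ∷ vs) (a , b , ab∈ , b<a , a<s) with ∈ₚ.∈-++⁻ (subseqs vs) ab∈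
  ... | inj₁ ab∈vs = trans (cong (not ((w <ᵇ s) ∧ any (_<ᵇ w) vs) ∧_) (from vs (a , b , ab∈vs , b<a , a<s)))
                           (Boolₚ.∧-zeroʳ _)
  ... | inj₂ ab∈w∷ with ∈ₚ.∈-map⁻ (w ∷_) ab∈w∷
  ...   | _ , b∈ , refl = cong₂ (λ p q → not (p ∧ q) ∧ increasingBelowᵇ s vs)
          (<⇒<ᵇ≡true a<s) (any≡true⁺ {p = _<ᵇ w} (subseqs-⊆ {ws = vs} b∈ (here refl)) (<⇒<ᵇ≡true b<a))

increasingBelowᵇ-map : ∀ {φ} s t → OrderEmbedding φ → (∀ v → (φ v <ᵇ t) ≡ (v <ᵇ s)) →
  ∀ zs → increasingBelowᵇ t (map φ zs) ≡ increasingBelowᵇ s zs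
increasingBelowᵇ-map         s t emb bound []       = refl
increasingBelowᵇ-map {φ = φ} s t emb bound (z ∷ zs) = cong₂ _∧_
  (cong not (cong₂ _∧_ (bound z) (trans (any-map (_<ᵇ φ z) φ zs) (any-cong (λ y → emb y z) zs))))
  (increasingBelowᵇ-map s t emb bound zs)

increasingBelowᵇ-1 : ∀ zs → All (1 ≤_) zs → increasingBelowᵇ 1 zs ≡ true
increasingBelowᵇ-1 []       []            = refl
increasingBelowᵇ-1 (z ∷ zs) (1≤z ∷ 1≤zs) rewrite ≥⇒<ᵇ≡false 1≤z = increasingBelowᵇ-1 zs 1≤zs

increasingBelowᵇ-antitone : ∀ {s t} ws → s ≤ t → increasingBelowᵇ t ws ≡ true → increasingBelowᵇ s ws ≡ true
increasingBelowᵇ-antitone {s} {t} ws s≤t incr with increasingBelowᵇ s ws in e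
... | true  = refl
... | false with Equivalence.to (increasingBelowᵇ≡false⇔ s ws) e
...   | a , b , ab∈ , b<a , a<s = contradiction
  (trans (sym incr) (Equivalence.from (increasingBelowᵇ≡false⇔ t ws) (a , b , ab∈ , b<a , ℕₚ.<-≤-trans a<s s≤t)))
  λ ()

orderIsoᵇ-321⁻ : ∀ s σ → orderIsoᵇ (s ∷ σ) (3 ∷ 2 ∷ 1 ∷ []) ≡ true →
  ∃₂ λ a b → σ ≡ a ∷ b ∷ [] × b < a × a < s
orderIsoᵇ-321⁻ s σ iso with orderIsoᵇ-sound (s ∷ σ) (3 ∷ 2 ∷ 1 ∷ []) iso
orderIsoᵇ-321⁻ s (a ∷ b ∷ []) iso | _ , same =
  a , b , refl , <ᵇ≡true⇒< b a (same (there (there (here refl))) (there (here refl)))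
               , <ᵇ≡true⇒< a s (same (there (here refl)) (here refl))

orderIsoᵇ-321⁺ : ∀ {s a b} → b < a → a < s → orderIsoᵇ (s ∷ a ∷ b ∷ []) (3 ∷ 2 ∷ 1 ∷ []) ≡ true
orderIsoᵇ-321⁺ {s} {a} {b} b<a a<s
  with b<s ← ℕₚ.<-trans b<a a<s
  rewrite ≥⇒<ᵇ≡false (ℕₚ.≤-refl {s}) | ≥⇒<ᵇ≡false (ℕₚ.<⇒≤ a<s) | ≥⇒<ᵇ≡false (ℕₚ.<⇒≤ b<s)
        | <⇒<ᵇ≡true a<s | ≥⇒<ᵇ≡false (ℕₚ.≤-refl {a}) | ≥⇒<ᵇ≡false (ℕₚ.<⇒≤ b<a)
        | <⇒<ᵇ≡true b<s | <⇒<ᵇ≡true b<a | ≥⇒<ᵇ≡false (ℕₚ.≤-refl {b}) = refl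

321-at-head : ∀ s ws →
  any (λ σ → orderIsoᵇ (s ∷ σ) (3 ∷ 2 ∷ 1 ∷ [])) (subseqs ws) ≡ not (increasingBelowᵇ s ws)
321-at-head s ws = ⇔⇒≡not (mk⇔ to from) (increasingBelowᵇ≡false⇔ s ws)
  where
  to : any (λ σ → orderIsoᵇ (s ∷ σ) (3 ∷ 2 ∷ 1 ∷ [])) (subseqs ws) ≡ true → InversionBelow s ws
  to h with any≡true⁻ _ (subseqs ws) h
  ... | σ , σ∈ , iso with orderIsoᵇ-321⁻ s σ iso
  ...   | a , b , refl , b<a , a<s = a , b , σ∈ , b<a , a<s
  from : InversionBelow s ws → any (λ σ → orderIsoᵇ (s ∷ σ) (3 ∷ 2 ∷ 1 ∷ [])) (subseqs ws) ≡ true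
  from (a , b , ab∈ , b<a , a<s) = any≡true⁺ ab∈ (orderIsoᵇ-321⁺ b<a a<s)

matched-entry-≥ : ∀ {a b} → length a ≡ length b → SameOrder a b → All (1 ≤_) a →
  ∀ v → 1 ≤ v → (∀ u → 1 ≤ u → u ≤ v → u ∈ b) → ∃ λ x → (x , v) ∈ zip a b × v ≤ x
matched-entry-≥ len same pos (suc zero) _ onto with zip-∈ʳ len (onto 1 ℕₚ.≤-refl ℕₚ.≤-refl)
... | x , x1∈ = x , x1∈ , All.lookup pos (zip-∈ˡ x1∈)
matched-entry-≥ len same pos (suc (suc v)) _ onto
  with matched-entry-≥ len same pos (suc v) (s≤s z≤n) (λ u 1≤u u≤ → onto u 1≤u (ℕₚ.m≤n⇒m≤1+n u≤))
     | zip-∈ʳ len (onto (suc (suc v)) (s≤s z≤n) ℕₚ.≤-refl)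
... | x′ , x′∈ , 1+v≤x′ | x , x∈ =
  x , x∈ , ℕₚ.≤-<-trans 1+v≤x′ (<ᵇ≡true⇒< x′ x (trans (same x′∈ x∈) (<⇒<ᵇ≡true (ℕₚ.n<1+n (suc v)))))

orderIsoᵇ-head-below : ∀ {s k g σ rest} → 1 ≤ s → s < k → k ≤ g → All (1 ≤_) σ →
  (∀ u → 1 ≤ u → u < k → u ∈ g ∷ rest) → orderIsoᵇ (s ∷ σ) (g ∷ rest) ≡ false
orderIsoᵇ-head-below {s} {suc m} {g} {σ} {rest} 1≤s (s≤s s≤m) m<g pos onto
  with orderIsoᵇ (s ∷ σ) (g ∷ rest) in iso
... | false = refl
... | true with orderIsoᵇ-sound (s ∷ σ) (g ∷ rest) iso
...   | len , same
  with matched-entry-≥ len same (1≤s ∷ pos) m (ℕₚ.≤-trans 1≤s s≤m) (λ u 1≤u u≤m → onto u 1≤u (s≤s u≤m))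
...     | x , xm∈ , m≤x = contradiction
  (ℕₚ.≤-<-trans m≤x (<ᵇ≡true⇒< x s (trans (same xm∈ (here refl)) (<⇒<ᵇ≡true m<g)))) (ℕₚ.≤⇒≯ s≤m)

<⇒≤∸1 : ∀ {u k} → u < k → u ≤ k ∸ 1
<⇒≤∸1 {k = suc k} (s≤s u≤k) = u≤k

gon₁-contains : ∀ k u → 1 ≤ u → u < k → u ∈ gon₁ k
gon₁-contains k (suc zero)    _ _   = there (∈ₚ.∈-++⁺ʳ (range (k + 2) (k + k ∸ 1)) (here refl))
gon₁-contains k (suc (suc u)) _ u<k = there (∈ₚ.∈-++⁺ʳ (range (k + 2) (k + k ∸ 1))
  (there (there (∈ₚ.∈-++⁺ˡ (∈-range⁺ 2 (k ∸ 1) (s≤s (s≤s z≤n)) (<⇒≤∸1 u<k))))))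

gon₂-contains : ∀ k u → 1 ≤ u → u < k → u ∈ gon₂ k
gon₂-contains k (suc zero)    _ _   = there (∈ₚ.∈-++⁺ʳ (range (k + 2) (k + k ∸ 1)) (there (here refl)))
gon₂-contains k (suc (suc u)) _ u<k = there (∈ₚ.∈-++⁺ʳ (range (k + 2) (k + k ∸ 1))
  (there (there (∈ₚ.∈-++⁺ˡ (∈-range⁺ 2 (k ∸ 1) (s≤s (s≤s z≤n)) (<⇒≤∸1 u<k))))))

gon₃-contains : ∀ k u → 1 ≤ u → u < k → u ∈ gon₃ k
gon₃-contains k (suc zero)    _ _   = there (∈ₚ.∈-++⁺ʳ (range (k + 2) (k + k ∸ 1)) (here refl))
gon₃-contains k (suc (suc u)) _ u<k = there (∈ₚ.∈-++⁺ʳ (range (k + 2) (k + k ∸ 1))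
  (there (there (∈-range⁺ 2 k (s≤s (s≤s z≤n)) (ℕₚ.<⇒≤ u<k)))))

gon₄-contains : ∀ k u → 1 ≤ u → u < k → u ∈ gon₄ k
gon₄-contains k (suc zero)    _ _   = there (∈ₚ.∈-++⁺ʳ (range (k + 2) (k + k ∸ 1)) (there (here refl)))
gon₄-contains k (suc (suc u)) _ u<k = there (∈ₚ.∈-++⁺ʳ (range (k + 2) (k + k ∸ 1))
  (there (there (∈-range⁺ 2 k (s≤s (s≤s z≤n)) (ℕₚ.<⇒≤ u<k)))))

avoidsᵇ-321-head : ∀ s zs → avoidsᵇ (s ∷ map (punchIn s) zs) (3 ∷ 2 ∷ 1 ∷ [])
                          ≡ avoidsᵇ zs (3 ∷ 2 ∷ 1 ∷ []) ∧ increasingBelowᵇ s zs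
avoidsᵇ-321-head s zs = begin
  not (containsᵇ (s ∷ ws) τ)
    ≡⟨ cong not (containsᵇ-cons s ws τ) ⟩
  not (containsᵇ ws τ ∨ any (λ σ → orderIsoᵇ (s ∷ σ) τ) (subseqs ws))
    ≡⟨ cong (λ b → not (containsᵇ ws τ ∨ b)) (321-at-head s ws) ⟩
  not (containsᵇ ws τ ∨ not (increasingBelowᵇ s ws))
    ≡⟨ cong₂ (λ b c → not (b ∨ not c)) (containsᵇ-map (punchIn-orderEmbedding s) zs τ)
             (increasingBelowᵇ-map s s (punchIn-orderEmbedding s) (punchIn-<ᵇ s) zs) ⟩
  not (containsᵇ zs τ ∨ not (increasingBelowᵇ s zs))
    ≡⟨ not-∨-not (containsᵇ zs τ) (increasingBelowᵇ s zs) ⟩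
  not (containsᵇ zs τ) ∧ increasingBelowᵇ s zs ∎
  where
  open ≡-Reasoning
  ws = map (punchIn s) zs
  τ = 3 ∷ 2 ∷ 1 ∷ []

avoidsᵇ-gon-head : ∀ {k s g rest} zs → 1 ≤ s → s < k → All (1 ≤_) zs → k ≤ g →
  (∀ u → 1 ≤ u → u < k → u ∈ g ∷ rest) → avoidsᵇ (s ∷ map (punchIn s) zs) (g ∷ rest) ≡ avoidsᵇ zs (g ∷ rest)
avoidsᵇ-gon-head {k} {s} {g} {rest} zs 1≤s s<k pos k≤g onto = cong not (begin
  containsᵇ (s ∷ ws) τ
    ≡⟨ containsᵇ-cons s ws τ ⟩
  containsᵇ ws τ ∨ any (λ σ → orderIsoᵇ (s ∷ σ) τ) (subseqs ws)
    ≡⟨ cong (containsᵇ ws τ ∨_) (any≡false⁺ (subseqs ws) λ σ∈ →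
         orderIsoᵇ-head-below 1≤s s<k k≤g (positive σ∈) onto) ⟩
  containsᵇ ws τ ∨ false
    ≡⟨ Boolₚ.∨-identityʳ (containsᵇ ws τ) ⟩
  containsᵇ ws τ
    ≡⟨ containsᵇ-map (punchIn-orderEmbedding s) zs τ ⟩
  containsᵇ zs τ ∎)
  where
  open ≡-Reasoning
  ws = map (punchIn s) zs
  τ = g ∷ rest
  positive : ∀ {σ} → σ ∈ subseqs ws → All (1 ≤_) σ
  positive σ∈ = All.tabulate (λ x∈σ → All.lookup (punchIn-positive s zs pos) (subseqs-⊆ σ∈ x∈σ))

kgonAvoidingᵇ-head : ∀ k s zs → 1 ≤ s → s < k → All (1 ≤_) zs →
  kgonAvoidingᵇ k (s ∷ map (punchIn s) zs) ≡ kgonAvoidingᵇ k zs ∧ increasingBelowᵇ s zs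
kgonAvoidingᵇ-head k s zs 1≤s s<k pos = trans
  (cong₂ _∧_ (avoidsᵇ-321-head s zs)
    (cong₂ _∧_ (gon ℕₚ.≤-refl (gon₁-contains k))
      (cong₂ _∧_ (gon ℕₚ.≤-refl (gon₂-contains k))
        (cong₂ _∧_ (gon (ℕₚ.n≤1+n k) (gon₃-contains k)) (gon (ℕₚ.n≤1+n k) (gon₄-contains k))))))
  (∧-rotate (avoidsᵇ zs (3 ∷ 2 ∷ 1 ∷ [])) (increasingBelowᵇ s zs) _)
  where
  gon : ∀ {g rest} → k ≤ g → (∀ u → 1 ≤ u → u < k → u ∈ g ∷ rest) →
        avoidsᵇ (s ∷ map (punchIn s) zs) (g ∷ rest) ≡ avoidsᵇ zs (g ∷ rest)
  gon = avoidsᵇ-gon-head zs 1≤s s<k pos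
  ∧-rotate : ∀ a b c → (a ∧ b) ∧ c ≡ (a ∧ c) ∧ b
  ∧-rotate a b c = trans (Boolₚ.∧-assoc a b c)
    (trans (cong (a ∧_) (Boolₚ.∧-comm b c)) (sym (Boolₚ.∧-assoc a c b)))

kgonAvoidingᵇ⇒increasingBelowᵇ : ∀ k x ys → kgonAvoidingᵇ k (x ∷ ys) ≡ true → increasingBelowᵇ x ys ≡ true
kgonAvoidingᵇ⇒increasingBelowᵇ k x ys avoiding = trans (sym (Boolₚ.not-involutive _)) (cong not no-321-at-x)
  where
  τ = 3 ∷ 2 ∷ 1 ∷ []
  no-321 : containsᵇ ys τ ∨ any (λ σ → orderIsoᵇ (x ∷ σ) τ) (subseqs ys) ≡ false
  no-321 = trans (sym (containsᵇ-cons x ys τ))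
    (trans (sym (Boolₚ.not-involutive _)) (cong not (Boolₚ.∧-conicalˡ (avoidsᵇ (x ∷ ys) τ) _ avoiding)))
  no-321-at-x : not (increasingBelowᵇ x ys) ≡ false
  no-321-at-x = trans (sym (321-at-head x ys)) (Boolₚ.∨-conicalʳ (containsᵇ ys τ) _ no-321)

kgonAvoidingᵇ-large-head : ∀ k s x ws → s ≤ x →
  kgonAvoidingᵇ k (x ∷ ws) ∧ increasingBelowᵇ s (x ∷ ws) ≡ kgonAvoidingᵇ k (x ∷ ws)
kgonAvoidingᵇ-large-head k s x ws s≤x rewrite ≥⇒<ᵇ≡false s≤x with kgonAvoidingᵇ k (x ∷ ws) in avoiding
... | true  = increasingBelowᵇ-antitone ws s≤x (kgonAvoidingᵇ⇒increasingBelowᵇ k x ws avoiding)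
... | false = refl

-- Recurrences for f_k(n; s)

fIncreasingBelow : ℕ → ℕ → ℕ → ℕ
fIncreasingBelow k M s = count (λ zs → kgonAvoidingᵇ k zs ∧ increasingBelowᵇ s zs) (perms M)

fPreFrom : ℕ → ℕ → ℕ → ℕ
fPreFrom k N s = sum (map (λ x → fPre k N (x ∷ [])) (interval s (suc N ∸ s)))

fPre-suc : ∀ k M x → 1 ≤ x → x ≤ suc M →
  fPre k (suc M) (x ∷ []) ≡ count (λ zs → kgonAvoidingᵇ k (x ∷ map (punchIn x) zs)) (perms M)
fPre-suc k = count-perms-suc-head (kgonAvoidingᵇ k)

fPre≡fIncreasingBelow : ∀ k M s → 1 ≤ s → s < k → s ≤ suc M →
  fPre k (suc M) (s ∷ []) ≡ fIncreasingBelow k M s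
fPre≡fIncreasingBelow k M s 1≤s s<k s≤1+M = trans (fPre-suc k M s 1≤s s≤1+M)
  (count-cong (perms M) (λ {zs} zs∈ → kgonAvoidingᵇ-head k s zs 1≤s s<k (perms-positive M zs∈)))

fIncreasingBelow-1 : ∀ k M → fIncreasingBelow k M 1 ≡ f k M
fIncreasingBelow-1 k M = count-cong (perms M) (λ {zs} zs∈ →
  trans (cong (kgonAvoidingᵇ k zs ∧_) (increasingBelowᵇ-1 zs (perms-positive M zs∈))) (Boolₚ.∧-identityʳ _))

f≡fPreFrom-1 : ∀ k M → f k (suc M) ≡ fPreFrom k (suc M) 1
f≡fPreFrom-1 k M = trans (count-perms-suc (kgonAvoidingᵇ k) M)
  (cong sum (map-cong-∈ (interval 1 (suc M)) (λ {x} x∈ →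
    sym (fPre-suc k M x (proj₁ (∈-interval⁻ 1 (suc M) x∈)) (ℕₚ.≤-pred (proj₂ (∈-interval⁻ 1 (suc M) x∈)))))))

fPreFrom-cons : ∀ k N s → s ≤ N → fPreFrom k N s ≡ fPre k N (s ∷ []) + fPreFrom k N (suc s)
fPreFrom-cons k N s s≤N =
  cong (λ l → sum (map (λ x → fPre k N (x ∷ [])) (interval s l))) (ℕₚ.+-∸-assoc 1 s≤N)

punchIn-1-<ᵇ : ∀ t v → (punchIn 1 v <ᵇ 2 + t) ≡ (v <ᵇ 1 + t)
punchIn-1-<ᵇ t zero    = refl
punchIn-1-<ᵇ t (suc v) = refl

count-small-head≡0 : ∀ k M s x → 1 < x → x < s → x ≤ suc M →
  count (λ zs → kgonAvoidingᵇ k (x ∷ map (punchIn x) zs) ∧ increasingBelowᵇ s (x ∷ map (punchIn x) zs)) (perms M)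
    ≡ 0
count-small-head≡0 k zero    s x 1<x x<s x≤1 = contradiction 1<x (ℕₚ.≤⇒≯ x≤1)
count-small-head≡0 k (suc M) s x 1<x x<s _   = count-none (perms (suc M)) (λ {zs} zs∈ →
  trans (cong (kgonAvoidingᵇ k (x ∷ map (punchIn x) zs) ∧_) (inversion-at-head zs∈)) (Boolₚ.∧-zeroʳ _))
  where
  inversion-at-head : ∀ {zs} → zs ∈ perms (suc M) → increasingBelowᵇ s (x ∷ map (punchIn x) zs) ≡ false
  inversion-at-head {zs} zs∈ = cong₂ (λ b c → not (b ∧ c) ∧ increasingBelowᵇ s (map (punchIn x) zs))
    (<⇒<ᵇ≡true x<s)
    (any≡true⁺ (subst (_∈ map (punchIn x) zs) (punchIn-< 1<x) (∈ₚ.∈-map⁺ (punchIn x) (1∈perms M zs∈)))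
               (<⇒<ᵇ≡true 1<x))

fIncreasingBelow-split : ∀ k M t → t ≤ M → 2 + t ≤ k →
  fIncreasingBelow k (suc M) (2 + t) ≡ fPre k (suc M) (1 + t ∷ []) + fPreFrom k (suc M) (2 + t)
fIncreasingBelow-split k M t t≤M 2+t≤k = begin
  fIncreasingBelow k (suc M) (2 + t)
    ≡⟨ count-perms-suc _ M ⟩
  block 1 + sum (map block (interval 2 M))
    ≡⟨ cong (λ l → block 1 + sum (map block (interval 2 l))) (sym (ℕₚ.m+[n∸m]≡n t≤M)) ⟩
  block 1 + sum (map block (interval 2 (t + (M ∸ t))))
    ≡⟨ cong (λ bs → block 1 + sum (map block bs)) (interval-++ 2 t (M ∸ t)) ⟩
  block 1 + sum (map block (interval 2 t ++ interval (2 + t) (M ∸ t)))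
    ≡⟨ cong (λ n → block 1 + n)
         (trans (cong sum (Listₚ.map-++ block small large)) (Sumₚ.sum-++ (map block small) (map block large))) ⟩
  block 1 + (sum (map block (interval 2 t)) + sum (map block (interval (2 + t) (M ∸ t))))
    ≡⟨ cong₂ _+_ block-1 (cong₂ _+_ (sum-map-zero small block-small) (cong sum (map-cong-∈ large block-large))) ⟩
  fPre k (suc M) (1 + t ∷ []) + (0 + fPreFrom k (suc M) (2 + t)) ∎
  where
  open ≡-Reasoning
  small = interval 2 t
  large = interval (2 + t) (M ∸ t)
  block : ℕ → ℕ
  block x = count (λ zs → kgonAvoidingᵇ k (x ∷ map (punchIn x) zs)
                        ∧ increasingBelowᵇ (2 + t) (x ∷ map (punchIn x) zs)) (perms M)
  block-1 : block 1 ≡ fPre k (suc M) (1 + t ∷ [])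
  block-1 = trans (count-cong (perms M) relabel)
    (sym (fPre≡fIncreasingBelow k M (1 + t) (s≤s z≤n) 2+t≤k (s≤s t≤M)))
    where
    relabel : ∀ {zs} → zs ∈ perms M →
      kgonAvoidingᵇ k (1 ∷ map (punchIn 1) zs) ∧ increasingBelowᵇ (2 + t) (1 ∷ map (punchIn 1) zs)
        ≡ kgonAvoidingᵇ k zs ∧ increasingBelowᵇ (1 + t) zs
    relabel {zs} zs∈ = cong₂ _∧_
      (trans (kgonAvoidingᵇ-head k 1 zs ℕₚ.≤-refl (ℕₚ.<-≤-trans (s≤s (s≤s z≤n)) 2+t≤k) pos)
        (trans (cong (kgonAvoidingᵇ k zs ∧_) (increasingBelowᵇ-1 zs pos)) (Boolₚ.∧-identityʳ _)))
      (cong₂ (λ b c → not b ∧ c)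
        (any≡false⁺ (map (punchIn 1) zs) (λ {v} v∈ → ≥⇒<ᵇ≡false (All.lookup (punchIn-positive 1 zs pos) v∈)))
        (increasingBelowᵇ-map (1 + t) (2 + t) (punchIn-orderEmbedding 1) (punchIn-1-<ᵇ t) zs))
      where pos = perms-positive M zs∈
  block-small : ∀ {x} → x ∈ interval 2 t → block x ≡ 0
  block-small {x} x∈ with ∈-interval⁻ 2 t x∈
  ... | 2≤x , x<2+t =
    count-small-head≡0 k M (2 + t) x 2≤x x<2+t (ℕₚ.≤-pred (ℕₚ.<-≤-trans x<2+t (s≤s (s≤s t≤M))))
  block-large : ∀ {x} → x ∈ interval (2 + t) (M ∸ t) → block x ≡ fPre k (suc M) (x ∷ [])
  block-large {x} x∈ with ∈-interval⁻ (2 + t) (M ∸ t) x∈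
  ... | 2+t≤x , x< = trans
    (count-cong (perms M) (λ {zs} _ → kgonAvoidingᵇ-large-head k (2 + t) x (map (punchIn x) zs) 2+t≤x))
    (sym (fPre-suc k M x (ℕₚ.≤-trans (s≤s z≤n) 2+t≤x)
                         (ℕₚ.≤-pred (subst (x <_) (cong (λ n → 2 + n) (ℕₚ.m+[n∸m]≡n t≤M)) x<))))

fPre-1 : ∀ k N → 1 < k → fPre k (suc N) (1 ∷ []) ≡ f k N
fPre-1 k N 1<k = trans (fPre≡fIncreasingBelow k N 1 ℕₚ.≤-refl 1<k (s≤s z≤n)) (fIncreasingBelow-1 k N)

fPre-2 : ∀ k M → 2 < k → fPre k (2 + M) (2 ∷ []) ≡ f k (suc M)
fPre-2 k M 2<k = begin
  fPre k (2 + M) (2 ∷ [])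
    ≡⟨ fPre≡fIncreasingBelow k (suc M) 2 (s≤s z≤n) 2<k (s≤s (s≤s z≤n)) ⟩
  fIncreasingBelow k (suc M) 2
    ≡⟨ fIncreasingBelow-split k M 0 z≤n (ℕₚ.<⇒≤ 2<k) ⟩
  fPre k (suc M) (1 ∷ []) + fPreFrom k (suc M) 2
    ≡⟨ fPreFrom-cons k (suc M) 1 (s≤s z≤n) ⟨
  fPreFrom k (suc M) 1
    ≡⟨ f≡fPreFrom-1 k M ⟨
  f k (suc M) ∎
  where open ≡-Reasoning

fPre-recurrence : ∀ k M u → 3 + u < k → 3 + u ≤ 2 + M →
  fPre k (2 + M) (2 + u ∷ []) ≡ fPre k (suc M) (1 + u ∷ []) + fPre k (2 + M) (3 + u ∷ [])
fPre-recurrence k M u 3+u<k 3+u≤2+M = begin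
  fPre k (2 + M) (2 + u ∷ [])
    ≡⟨ fPre≡fIncreasingBelow k (suc M) (2 + u) (s≤s z≤n) 2+u<k (ℕₚ.m≤n⇒m≤1+n 2+u≤1+M) ⟩
  fIncreasingBelow k (suc M) (2 + u)
    ≡⟨ fIncreasingBelow-split k M u (ℕₚ.≤-trans (ℕₚ.n≤1+n u) 1+u≤M) (ℕₚ.<⇒≤ 2+u<k) ⟩
  fPre k (suc M) (1 + u ∷ []) + fPreFrom k (suc M) (2 + u)
    ≡⟨ cong (λ n → fPre k (suc M) (1 + u ∷ []) + n) (fPreFrom-cons k (suc M) (2 + u) 2+u≤1+M) ⟩
  fPre k (suc M) (1 + u ∷ []) + (fPre k (suc M) (2 + u ∷ []) + fPreFrom k (suc M) (3 + u))
    ≡⟨ cong (λ n → fPre k (suc M) (1 + u ∷ []) + n)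
            (fIncreasingBelow-split k M (1 + u) 1+u≤M (ℕₚ.<⇒≤ 3+u<k)) ⟨
  fPre k (suc M) (1 + u ∷ []) + fIncreasingBelow k (suc M) (3 + u)
    ≡⟨ cong (λ n → fPre k (suc M) (1 + u ∷ []) + n)
            (fPre≡fIncreasingBelow k (suc M) (3 + u) (s≤s z≤n) 3+u<k 3+u≤2+M) ⟨
  fPre k (suc M) (1 + u ∷ []) + fPre k (2 + M) (3 + u ∷ []) ∎
  where
  open ≡-Reasoning
  2+u<k = ℕₚ.<-trans (ℕₚ.n<1+n (2 + u)) 3+u<k
  2+u≤1+M = ℕₚ.≤-pred 3+u≤2+M
  1+u≤M = ℕₚ.≤-pred 2+u≤1+M

-- Alternating binomial sums

∑< : ℕ → (ℕ → ℤ) → ℤ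
∑< zero    h = + 0
∑< (suc s) h = h 0 +ℤ ∑< s (h ∘ suc)

sumℤ-map-applyUpTo : ∀ (h : ℕ → ℤ) g s → sumℤ (map h (applyUpTo g s)) ≡ ∑< s (h ∘ g)
sumℤ-map-applyUpTo h g zero    = refl
sumℤ-map-applyUpTo h g (suc s) = cong (h (g 0) +ℤ_) (sumℤ-map-applyUpTo h (g ∘ suc) s)

∑<-cong : ∀ s {h h′ : ℕ → ℤ} → (∀ j → j < s → h j ≡ h′ j) → ∑< s h ≡ ∑< s h′
∑<-cong zero    _  = refl
∑<-cong (suc s) h≗ = cong₂ _+ℤ_ (h≗ 0 (s≤s z≤n)) (∑<-cong s (λ j j<s → h≗ (suc j) (s≤s j<s)))

∑<-last : ∀ s (h : ℕ → ℤ) → ∑< (suc s) h ≡ ∑< s h +ℤ h s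
∑<-last zero    h = ℤₚ.+-comm (h 0) (+ 0)
∑<-last (suc s) h = trans (cong (h 0 +ℤ_) (∑<-last s (h ∘ suc))) (sym (ℤₚ.+-assoc (h 0) _ _))

∑<-sub : ∀ s (h h′ : ℕ → ℤ) → ∑< s (λ j → h j -ℤ h′ j) ≡ ∑< s h -ℤ ∑< s h′
∑<-sub zero    h h′ = refl
∑<-sub (suc s) h h′ = trans (cong (h 0 -ℤ h′ 0 +ℤ_) (∑<-sub s (h ∘ suc) (h′ ∘ suc)))
  (interchange (h 0) (h′ 0) (∑< s (h ∘ suc)) (∑< s (h′ ∘ suc)))
  where
  interchange : ∀ a b c d → (a -ℤ b) +ℤ (c -ℤ d) ≡ (a +ℤ c) -ℤ (b +ℤ d)
  interchange = solve-∀

altCoeff : ℕ → ℕ → ℤ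
altCoeff s j = (- (+ 1)) ^ j * + ((s ∸ 1 ∸ j) C j)

alternatingSum : (ℕ → ℤ) → ℕ → ℤ
alternatingSum a s = ∑< s (λ j → altCoeff s j * a j)

∸≡suc∸suc : ∀ {t j} → j < t → t ∸ j ≡ suc (t ∸ suc j)
∸≡suc∸suc {suc t} {zero}  _         = refl
∸≡suc∸suc {suc t} {suc j} (s≤s j<t) = ∸≡suc∸suc j<t

altCoeff-pascal : ∀ t j → j < t → altCoeff (2 + t) (suc j) ≡ altCoeff (1 + t) (suc j) -ℤ altCoeff t j
altCoeff-pascal t j j<t = begin
  - (+ 1) * u * + ((t ∸ j) C suc j)
    ≡⟨ cong (λ n → - (+ 1) * u * + (n C suc j)) (∸≡suc∸suc j<t) ⟩
  - (+ 1) * u * + (suc r C suc j)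
    ≡⟨ cong (λ n → - (+ 1) * u * + n) (nCk+nC[k+1]≡[n+1]C[k+1] r j) ⟨
  - (+ 1) * u * (+ (r C j) +ℤ + (r C suc j))
    ≡⟨ sign-split u (+ (r C j)) (+ (r C suc j)) ⟩
  - (+ 1) * u * + (r C suc j) -ℤ u * + (r C j)
    ≡⟨ cong (λ n → - (+ 1) * u * + (r C suc j) -ℤ u * + (n C j)) (ℕₚ.∸-+-assoc t 1 j) ⟨
  altCoeff (1 + t) (suc j) -ℤ altCoeff t j ∎
  where
  open ≡-Reasoning
  u = (- (+ 1)) ^ j
  r = t ∸ suc j
  sign-split : ∀ u x y → - (+ 1) * u * (x +ℤ y) ≡ - (+ 1) * u * y -ℤ u * x
  sign-split = solve-∀

altCoeff-vanishes : ∀ t → altCoeff (2 + t) (suc t) ≡ + 0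
altCoeff-vanishes t rewrite ℕₚ.n∸n≡0 t = ℤₚ.*-zeroʳ ((- (+ 1)) ^ suc t)

alternatingSum-1 : ∀ a → alternatingSum a 1 ≡ a 0
alternatingSum-1 a = trans (ℤₚ.+-identityʳ _) (ℤₚ.*-identityˡ (a 0))

alternatingSum-rec : ∀ a t →
  alternatingSum a (2 + t) ≡ alternatingSum a (1 + t) -ℤ alternatingSum (a ∘ suc) t
alternatingSum-rec a t = begin
  c₀ +ℤ ∑< (suc t) (λ j → altCoeff (2 + t) (suc j) * a (suc j))
    ≡⟨ cong (c₀ +ℤ_) (∑<-last t (λ j → altCoeff (2 + t) (suc j) * a (suc j))) ⟩
  c₀ +ℤ (∑< t (λ j → altCoeff (2 + t) (suc j) * a (suc j)) +ℤ altCoeff (2 + t) (suc t) * a (suc t))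
    ≡⟨ cong₂ (λ x y → c₀ +ℤ (x +ℤ y)) (∑<-cong t pascal) (cong (_* a (suc t)) (altCoeff-vanishes t)) ⟩
  c₀ +ℤ (∑< t (λ j → altCoeff (1 + t) (suc j) * a (suc j) -ℤ altCoeff t j * a (suc j)) +ℤ + 0 * a (suc t))
    ≡⟨ cong (λ x → c₀ +ℤ (x +ℤ + 0 * a (suc t))) (∑<-sub t _ _) ⟩
  c₀ +ℤ ((P -ℤ Q) +ℤ + 0 * a (suc t))
    ≡⟨ regroup c₀ P Q (a (suc t)) ⟩
  (c₀ +ℤ P) -ℤ Q ∎
  where
  open ≡-Reasoning
  c₀ = altCoeff (2 + t) 0 * a 0
  P = ∑< t (λ j → altCoeff (1 + t) (suc j) * a (suc j))
  Q = ∑< t (λ j → altCoeff t j * a (suc j))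
  distribʳ : ∀ x y z → (x -ℤ y) * z ≡ x * z -ℤ y * z
  distribʳ = solve-∀
  pascal : ∀ j → j < t →
    altCoeff (2 + t) (suc j) * a (suc j) ≡ altCoeff (1 + t) (suc j) * a (suc j) -ℤ altCoeff t j * a (suc j)
  pascal j j<t = trans (cong (_* a (suc j)) (altCoeff-pascal t j j<t))
                       (distribʳ (altCoeff (1 + t) (suc j)) (altCoeff t j) (a (suc j)))
  regroup : ∀ c x y z → c +ℤ ((x -ℤ y) +ℤ + 0 * z) ≡ (c +ℤ x) -ℤ y
  regroup = solve-∀

alternatingSum-2 : ∀ a → alternatingSum a 2 ≡ a 0
alternatingSum-2 a = trans (alternatingSum-rec a 0) (trans (ℤₚ.+-identityʳ _) (alternatingSum-1 a))

fPre≡alternatingSum : ∀ k s n → 1 ≤ s → s < k → s ≤ n →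
  + fPre k n (s ∷ []) ≡ alternatingSum (λ j → + f k (n ∸ 1 ∸ j)) s
fPre≡alternatingSum k 1 (suc N) _ 1<k _ =
  trans (cong +_ (fPre-1 k N 1<k)) (sym (alternatingSum-1 (λ j → + f k (N ∸ j))))
fPre≡alternatingSum k 2 (suc (suc M)) _ 2<k _ =
  trans (cong +_ (fPre-2 k M 2<k)) (sym (alternatingSum-2 (λ j → + f k (suc M ∸ j))))
fPre≡alternatingSum k (suc (suc (suc t))) (suc (suc M)) _ 3+t<k 3+t≤n = begin
  + fPre k n (3 + t ∷ [])
    ≡⟨ cancel (+ fPre k (suc M) (1 + t ∷ [])) (+ fPre k n (3 + t ∷ [])) ⟩
  (+ fPre k (suc M) (1 + t ∷ []) +ℤ + fPre k n (3 + t ∷ [])) -ℤ + fPre k (suc M) (1 + t ∷ [])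
    ≡⟨ cong (λ x → + x -ℤ + fPre k (suc M) (1 + t ∷ [])) (fPre-recurrence k M t 3+t<k 3+t≤n) ⟨
  + fPre k n (2 + t ∷ []) -ℤ + fPre k (suc M) (1 + t ∷ [])
    ≡⟨ cong₂ _-ℤ_ (fPre≡alternatingSum k (suc (suc t)) (suc (suc M)) (s≤s z≤n) 2+t<k 2+t≤n)
                  (fPre≡alternatingSum k (suc t) (suc M) (s≤s z≤n) 1+t<k (ℕₚ.≤-pred 2+t≤n)) ⟩
  alternatingSum a (2 + t) -ℤ alternatingSum (a ∘ suc) (1 + t)
    ≡⟨ alternatingSum-rec a (1 + t) ⟨
  alternatingSum a (3 + t) ∎
  where
  open ≡-Reasoning
  n = suc (suc M)
  a = λ j → + f k (n ∸ 1 ∸ j)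
  2+t<k = ℕₚ.<-trans (ℕₚ.n<1+n (2 + t)) 3+t<k
  1+t<k = ℕₚ.<-trans (ℕₚ.n<1+n (1 + t)) 2+t<k
  2+t≤n = ℕₚ.≤-trans (ℕₚ.n≤1+n (2 + t)) 3+t≤n
  cancel : ∀ y z → z ≡ (y +ℤ z) -ℤ y
  cancel = solve-∀
fPre≡alternatingSum k (suc (suc _)) (suc zero) _ _ (s≤s ())

proposition2p2 : (k n s : ℕ) → 2 ≤ k → 1 ≤ n → 1 ≤ s → s ≤ k ∸ 1 → s ≤ n →
    + fPre k n (s ∷ []) ≡
      sumℤ (map (λ j → ((- (+ 1)) ^ j) * (+ ((s ∸ 1 ∸ j) C j)) * (+ f k (n ∸ 1 ∸ j))) (upTo s))
-- The hypotheses 2 ≤ k and 1 ≤ n follow from 1 ≤ s ≤ k ∸ 1 and s ≤ n.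
proposition2p2 (suc k) n s _ _ 1≤s s≤k s≤n =
  trans (fPre≡alternatingSum (suc k) s n 1≤s (s≤s s≤k) s≤n)
        (sym (sumℤ-map-applyUpTo (λ j → altCoeff s j * + f (suc k) (n ∸ 1 ∸ j)) (λ j → j) s))
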